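{- Let $G$ be a directed graph. If $b\in L(G)$ has length $2n+2$, then there is an infinite interval of $L(G)$ containing $b$ all of whose elements have length at least $2n+2$.
   Context: A directed graph is $G=(V,E)$ with $E$ binary and $V\subseteq\omega$. Fix an effective partition $(A_n)_{n\in\omega}$ of $\mathbb{Q}$ into pairwise disjoint dense sets, and an effective list $(t_m)_{1\le m<\omega}$ of all atomic types in $\{E\}$ of tuples of distinct elements, with $t_1$ the type of the empty tuple, then types of single elements, then of pairs, then triples, etc. $L(G)$ is the set of finite sequences of rationals $r_0q_1r_1\ldots r_{n-1}q_nr_nk$ ($n\ge0$) with $r_i\in A_0$ ($i<n$), $r_n\in A_1$, distinct $a_1,\dots,a_n\in V$ with $q_i\in A_{a_i}$ and $(a_1,\dots,a_n)$ realizing $t_m$ in $G$, and $k\in\omega$, $k<m$; ordered lexicographically. The length of an element is its length as a finite sequence. -}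

module Defs where

open import Data.Nat using (ℕ; zero; suc; _+_; _*_; _≤_; _<_)
open import Data.Bool using (Bool; true)
open import Data.Fin using (Fin; inject₁; fromℕ; cast)
open import Data.Vec using (Vec; []; _∷_; lookup)
open import Data.List using (List; []; _∷_; _++_; length)
open import Data.List.Membership.Propositional using (_∈_)
open import Data.Product using (Σ; ∃; _×_; _,_; proj₁)
open import Relation.Binary.PropositionalEquality using (_≡_)
open import Relation.Nullary using (¬_)
open import Function.Bundles using (_⇔_)
open import Data.Rational as ℚ using (ℚ)
open import Data.Integer using (+_)
open import Data.List.Relation.Binary.Lex.Strict using (Lex-<)

-- The partition (A_n) of ℚ: given as the function assigning to each
-- rational the index n of the unique part A_n containing it.
-- (Pairwise disjointness and covering are built in.)  Each part is dense.

IsDensePartition : (ℚ → ℕ) → Set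
IsDensePartition A =
  ∀ (n : ℕ) (p q : ℚ) → p ℚ.< q → ∃ λ r → p ℚ.< r × r ℚ.< q × A r ≡ n

record Digraph : Set₁ where
  field
    V : ℕ → Set
    E : ℕ → ℕ → Set

-- Atomic types in {E} of tuples of distinct elements: an n-ary type is
-- determined by the n×n table recording which E(x_i,x_j) hold
-- (including i = j).

AtType : Set
AtType = Σ ℕ λ n → Vec (Vec Bool n) n

arity : AtType → ℕ
arity = proj₁

Realizes : (G : Digraph) → ∀ {n} → Vec ℕ n → AtType → Set
Realizes G {n} as (n' , τ) =
  Σ (n ≡ n') λ p → ∀ (i j : Fin n) →
    Digraph.E G (lookup as i) (lookup as j) ⇔ (lookup (lookup τ (cast p i)) (cast p j) ≡ true)

-- (t_m)_{1 ≤ m} is a list of all atomic types, without repetition,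
-- ordered by arity (so t_1 is the type of the empty tuple).
-- Index 0 is unused.
IsTypeList : (ℕ → AtType) → Set
IsTypeList t =
  (∀ (τ : AtType) → ∃ λ m → 1 ≤ m × t m ≡ τ) ×
  (∀ m m' → 1 ≤ m → 1 ≤ m' → t m ≡ t m' → m ≡ m') ×
  (∀ m m' → 1 ≤ m → m ≤ m' → arity (t m) ≤ arity (t m'))

word : ∀ {n} → Vec ℚ (suc n) → Vec ℚ n → List ℚ
word {zero} (r ∷ []) [] = r ∷ []
word {suc n} (r ∷ rs) (q ∷ qs) = r ∷ q ∷ word rs qs

Distinct : ∀ {n} → Vec ℕ n → Set
Distinct {n} as = ∀ (i j : Fin n) → lookup as i ≡ lookup as j → i ≡ j

InL : (A : ℚ → ℕ) (t : ℕ → AtType) (G : Digraph) → List ℚ → Set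
InL A t G x =
  Σ ℕ λ n → Σ (Vec ℚ (suc n)) λ rs → Σ (Vec ℚ n) λ qs → Σ (Vec ℕ n) λ as →
  Σ ℕ λ m → Σ ℕ λ k →
    x ≡ word rs qs ++ ((+ k) ℚ./ 1 ∷ []) ×
    (∀ (i : Fin n) → A (lookup rs (inject₁ i)) ≡ 0) ×
    A (lookup rs (fromℕ n)) ≡ 1 ×
    Distinct as ×
    (∀ (i : Fin n) → Digraph.V G (lookup as i)) ×
    (∀ (i : Fin n) → A (lookup qs i) ≡ lookup as i) ×
    1 ≤ m × Realizes G as (t m) ×
    k < m

_<L_ : List ℚ → List ℚ → Set
_<L_ = Lex-< _≡_ ℚ._<_

IsInterval : (A : ℚ → ℕ) (t : ℕ → AtType) (G : Digraph) → (List ℚ → Set) → Set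
IsInterval A t G I =
  (∀ x → I x → InL A t G x) ×
  (∀ x y z → I x → I z → InL A t G y → x <L y → y <L z → I y)

IsInfinite : (List ℚ → Set) → Set
IsInfinite I = ∀ (xs : List (List ℚ)) → ∃ λ y → I y × ¬ (y ∈ xs)

module Submission where

-- Let b ∈ L(G) have length 2n+2.  Writing an element of L(G) as a word
-- r₀ q₁ r₁ … q_m r_m followed by its counter k, we split b as p ++ r k,
-- where the stem p = r₀ q₁ … q_n has length 2n.  The interval is
--
--     I = { x ∈ L(G) : x = p ++ c d s for some rationals c, d and list s },
--
-- the elements of L(G) extending p by at least two entries.
--   * Convexity: in the lexicographic order, anything strictly between two
--     extensions of p is a proper extension of p; it cannot extend p by a
--     single entry, because elements of L(G) have even length and p ++ c
--     has odd length 2n+1.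
--   * Length: every element of I has length at least |p| + 2 = 2n+2.
--   * Infinitude: the entry r of b may be replaced by any rational of A₁,
--     and A₁, being dense, contains rationals above every entry of any
--     given finite list of sequences.

open import Defs
open import Data.Nat using (ℕ; _+_; _*_; _≤_)
open import Data.List using (List; length)
open import Data.Product using (Σ; _×_)
open import Data.Rational using (ℚ)
open import Relation.Binary.PropositionalEquality using (_≡_)

open import Data.Nat using (zero; suc; s≤s; z≤n)
open import Data.Nat.Properties using (even≢odd; *-suc; +-comm; +-cancelʳ-≡; +-monoʳ-≤; module ≤-Reasoning)
open import Data.List using ([]; _∷_; _++_; concat)
open import Data.List.Properties using (length-++)
open import Data.List.Membership.Propositional using (_∈_; _∉_)
open import Data.List.Membership.Propositional.Properties using (∈-++⁺ʳ; ∈-concat⁺′)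
open import Data.List.Relation.Unary.All as All using ()
open import Data.List.Relation.Unary.Any using (here)
open import Data.List.Relation.Binary.Lex.Core using (this; next; base)
open import Data.List.Relation.Binary.Lex.Strict using (Lex-<)
open import Data.Vec using (Vec; lookup; _[_]≔_) renaming ([] to []ᵛ; _∷_ to _∷ᵛ_)
open import Data.Vec.Properties using (lookup∘updateAt; lookup∘updateAt′)
open import Data.Fin using (inject₁; fromℕ)
open import Data.Fin.Properties using (fromℕ≢inject₁)
open import Data.Product using (_,_; proj₁; ∃; ∃-syntax)
open import Data.Empty using (⊥-elim)
open import Data.Unit using (tt)
open import Function using (_∘_)
open import Relation.Nullary using (¬_)
open import Relation.Nullary.Decidable using (toWitness)
open import Relation.Binary.Definitions using (Asymmetric)
open import Relation.Binary.Core using (Rel)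
open import Relation.Binary.Bundles using (DecTotalOrder)
open import Relation.Binary.PropositionalEquality using (refl; sym; trans; cong; subst; module ≡-Reasoning)
open import Data.Rational using (0ℚ; 1ℚ; _<_; _<?_) renaming (_+_ to _+ℚ_; _/_ to _/ℚ_)
open import Data.Rational.Properties using (<-asym; <-irrefl; <-≤-trans; +-monoʳ-<; +-identityʳ; ≤-decTotalOrder)
open import Data.Integer using (+_)
open import Data.List.Extrema (DecTotalOrder.totalOrder ≤-decTotalOrder) using (max; xs≤max)

-- In the lexicographic order induced by an asymmetric relation, every list
-- lying strictly between two extensions of a prefix p is itself a proper
-- extension of p.  This is what makes the set of extensions of p convex.
module _ {a ℓ} {X : Set a} {_≺_ : Rel X ℓ} (≺-asym : Asymmetric _≺_) where

  between-extensions : ∀ (p s s' y : List X) →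
    Lex-< _≡_ _≺_ (p ++ s) y → Lex-< _≡_ _≺_ y (p ++ s') →
    ∃[ c ] ∃[ u ] y ≡ p ++ c ∷ u
  between-extensions [] [] _ [] (base ()) _
  between-extensions [] (_ ∷ _) _ [] () _
  between-extensions [] s s' (c ∷ u) _ _ = c , u , refl
  between-extensions (a ∷ p) s s' (b ∷ y) (this a≺b) (this b≺a) = ⊥-elim (≺-asym a≺b b≺a)
  between-extensions (a ∷ p) s s' (b ∷ y) (this a≺a) (next refl _) = ⊥-elim (≺-asym a≺a a≺a)
  between-extensions (a ∷ p) s s' (b ∷ y) (next refl _) (this a≺a) = ⊥-elim (≺-asym a≺a a≺a)
  between-extensions (a ∷ p) s s' (b ∷ y) (next refl lo) (next _ hi)
    with between-extensions p s s' y lo hi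
  ... | c , u , refl = c , u , refl

-- A dense part A_j of ℚ is unbounded above; hence it contains a rational
-- occurring in none of finitely many given sequences.
fresh-rational : ∀ {A : ℚ → ℕ} → IsDensePartition A → ∀ j (xss : List (List ℚ)) →
  ∃ λ r → A r ≡ j × (∀ {xs} → xs ∈ xss → r ∉ xs)
fresh-rational dense j xss =
  let r , M<r , _ , Ar = dense j M (M +ℚ 1ℚ) M<M+1 in
  r , Ar , λ xs∈xss r∈xs →
    <-irrefl refl (<-≤-trans M<r (All.lookup (xs≤max 0ℚ (concat xss)) (∈-concat⁺′ r∈xs xs∈xss)))
  where
  M : ℚ
  M = max 0ℚ (concat xss)
  M<M+1 : M < M +ℚ 1ℚ
  M<M+1 = subst (_< M +ℚ 1ℚ) (+-identityʳ M) (+-monoʳ-< M (toWitness {a? = 0ℚ <? 1ℚ} tt))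

stem : ∀ {n} → Vec ℚ (suc n) → Vec ℚ n → List ℚ
stem {zero} (r ∷ᵛ []ᵛ) []ᵛ = []
stem {suc n} (r ∷ᵛ rs) (q ∷ᵛ qs) = r ∷ q ∷ stem rs qs

length-stem : ∀ {n} (rs : Vec ℚ (suc n)) (qs : Vec ℚ n) → length (stem rs qs) ≡ 2 * n
length-stem {zero} (r ∷ᵛ []ᵛ) []ᵛ = refl
length-stem {suc n} (r ∷ᵛ rs) (q ∷ᵛ qs) =
  trans (cong (suc ∘ suc) (length-stem rs qs)) (sym (*-suc 2 n))

word-split : ∀ {n} (rs : Vec ℚ (suc n)) (qs : Vec ℚ n) (tl : List ℚ) →
  word rs qs ++ tl ≡ stem rs qs ++ lookup rs (fromℕ n) ∷ tl
word-split {zero} (r ∷ᵛ []ᵛ) []ᵛ tl = refl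
word-split {suc n} (r ∷ᵛ rs) (q ∷ᵛ qs) tl = cong (λ w → r ∷ q ∷ w) (word-split rs qs tl)

word-reset : ∀ {n} (rs : Vec ℚ (suc n)) (qs : Vec ℚ n) (r : ℚ) (tl : List ℚ) →
  word (rs [ fromℕ n ]≔ r) qs ++ tl ≡ stem rs qs ++ r ∷ tl
word-reset {zero} (_ ∷ᵛ []ᵛ) []ᵛ r tl = refl
word-reset {suc n} (r₀ ∷ᵛ rs) (q ∷ᵛ qs) r tl = cong (λ w → r₀ ∷ q ∷ w) (word-reset rs qs r tl)

module _ (A : ℚ → ℕ) (t : ℕ → AtType) (G : Digraph) where

  split-last : ∀ {x} → InL A t G x →
    ∃[ p ] ∃[ r ] ∃[ k ] x ≡ p ++ r ∷ k ∷ [] ×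
      (∀ r' → A r' ≡ 1 → InL A t G (p ++ r' ∷ k ∷ []))
  split-last (n , rs , qs , as , m , k , x≡ , A₀ , A₁ , distinct , inV , Aq , 1≤m , realizes , k<m) =
    stem rs qs , lookup rs (fromℕ n) , kℚ , trans x≡ (word-split rs qs (kℚ ∷ [])) ,
    λ r' A₁r' → n , rs [ fromℕ n ]≔ r' , qs , as , m , k , sym (word-reset rs qs r' (kℚ ∷ [])) ,
      (λ i → trans (cong A (lookup∘updateAt′ (inject₁ i) (fromℕ n) (fromℕ≢inject₁ ∘ sym) rs)) (A₀ i)) ,
      trans (cong A (lookup∘updateAt (fromℕ n) rs)) A₁r' ,
      distinct , inV , Aq , 1≤m , realizes , k<m
    where
    kℚ : ℚ
    kℚ = (+ k) /ℚ 1

  length-even : ∀ {x} → InL A t G x → ∃ λ m → length x ≡ 2 * m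
  length-even {x} (n , rs , qs , _ , _ , k , x≡ , _) = suc n , (begin
    length x                                       ≡⟨ cong length (trans x≡ (word-split rs qs _)) ⟩
    length (stem rs qs ++ lookup rs (fromℕ n) ∷ _) ≡⟨ length-++ (stem rs qs) ⟩
    length (stem rs qs) + 2                        ≡⟨ cong (_+ 2) (length-stem rs qs) ⟩
    2 * n + 2                                      ≡⟨ +-comm (2 * n) 2 ⟩
    2 + 2 * n                                      ≡⟨ sym (*-suc 2 n) ⟩
    2 * suc n                                      ∎)
    where open ≡-Reasoning

  no-odd-extension : ∀ n p c → length p ≡ 2 * n → ¬ InL A t G (p ++ c ∷ [])
  no-odd-extension n p c |p| pc∈L =
    let m , |pc|≡2m = length-even pc∈L in
    even≢odd m n (trans (sym |pc|≡2m) (begin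
      length (p ++ c ∷ []) ≡⟨ length-++ p ⟩
      length p + 1         ≡⟨ cong (_+ 1) |p| ⟩
      2 * n + 1            ≡⟨ +-comm (2 * n) 1 ⟩
      suc (2 * n)          ∎))
    where open ≡-Reasoning

  LongExtensions : List ℚ → List ℚ → Set
  LongExtensions p x = InL A t G x × ∃[ c ] ∃[ d ] ∃[ s ] x ≡ p ++ c ∷ d ∷ s

  -- For a stem p of even length they form an interval of L(G): whatever
  -- lies between two of them extends p, and not by a single entry.
  long-extensions-interval : ∀ n p → length p ≡ 2 * n → IsInterval A t G (LongExtensions p)
  long-extensions-interval n p |p| = (λ _ → proj₁) , convex
    where
    convex : ∀ x y z → LongExtensions p x → LongExtensions p z → InL A t G y →
      x <L y → y <L z → LongExtensions p y
    convex _ y _ (_ , c , d , s , refl) (_ , c' , d' , s' , refl) y∈L x<y y<z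
      with between-extensions <-asym p (c ∷ d ∷ s) (c' ∷ d' ∷ s') y x<y y<z
    ... | e , [] , refl = ⊥-elim (no-odd-extension n p e |p| y∈L)
    ... | e , f ∷ u , refl = y∈L , e , f , u , refl

  long-extensions-long : ∀ n p → length p ≡ 2 * n →
    ∀ x → LongExtensions p x → 2 * n + 2 ≤ length x
  long-extensions-long n p |p| _ (_ , c , d , s , refl) = begin
    2 * n + 2                       ≤⟨ +-monoʳ-≤ (2 * n) (s≤s (s≤s z≤n)) ⟩
    2 * n + length (c ∷ d ∷ s)      ≡⟨ cong (_+ length (c ∷ d ∷ s)) (sym |p|) ⟩
    length p + length (c ∷ d ∷ s)   ≡⟨ sym (length-++ p) ⟩
    length (p ++ c ∷ d ∷ s)         ∎
    where open ≤-Reasoning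

  long-extensions-infinite : IsDensePartition A → ∀ p k →
    (∀ r → A r ≡ 1 → InL A t G (p ++ r ∷ k ∷ [])) → IsInfinite (LongExtensions p)
  long-extensions-infinite dense p k extend xss =
    let r , A₁r , r-fresh = fresh-rational dense 1 xss in
    p ++ r ∷ k ∷ [] , (extend r A₁r , r , k , [] , refl) ,
    λ y∈xss → r-fresh y∈xss (∈-++⁺ʳ p (here refl))

lemma3p4 : (A : ℚ → ℕ) → IsDensePartition A →
    (t : ℕ → AtType) → IsTypeList t →
    (G : Digraph) (n : ℕ) (b : List ℚ) →
    InL A t G b → length b ≡ 2 * n + 2 →
    Σ (List ℚ → Set) λ I →
      IsInterval A t G I × IsInfinite I × I b ×
      (∀ x → I x → 2 * n + 2 ≤ length x)
lemma3p4 A dense t _ G n b b∈L |b| with split-last A t G b∈L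
... | p , r , k , refl , extend =
  LongExtensions A t G p ,
  long-extensions-interval A t G n p |p| ,
  long-extensions-infinite A t G dense p k extend ,
  (b∈L , r , k , [] , refl) ,
  long-extensions-long A t G n p |p|
  where
  |p| : length p ≡ 2 * n
  |p| = +-cancelʳ-≡ 2 (length p) (2 * n) (trans (sym (length-++ p)) |b|)
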